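{- Let $p$ be a prime and let $d$ be a positive integer. There exist positive integers $u,v$ such that $\frac{4}{p}=\frac{1}{duv}+\frac{1}{dup}+\frac{1}{dvp}$ if and only if there exists a positive integer $n$ such that $p\equiv -n \pmod{4dn-1}$. Moreover, any such solution $(duv,dup,dvp)$ is of Type II.
   Context: For a positive integer $a$, a solution for $a$ is a triple of positive integers $(x,y,z)$ with $\frac{4}{a}=\frac1x+\frac1y+\frac1z$. A solution is of Type II if, after arranging its entries in nondecreasing order $x\le y\le z$, one has $\gcd(a,x)=1$ and $a\mid y$, $a\mid z$. A solution for $a$ of the form $(duv,dua,dva)$ with $d,u,v$ positive integers is called a Type B solution. -}

module Defs where

open import Data.Nat using (ℕ; _+_; _*_; _≤_)
open import Data.Nat.GCD using (gcd)
open import Data.Nat.Divisibility using (_∣_)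
open import Data.Product using (∃-syntax; _×_)
open import Relation.Binary.PropositionalEquality using (_≡_)

-- (x , y , z) is a solution for a:  x, y, z positive and 4/a = 1/x + 1/y + 1/z,
-- the latter written with denominators cleared (all quantities positive):
-- 4xyz = a(yz + xz + xy).
IsSolution : ℕ → ℕ → ℕ → ℕ → Set
IsSolution a x y z =
  1 ≤ x × 1 ≤ y × 1 ≤ z × 4 * x * y * z ≡ a * (y * z + x * z + x * y)

data IsArrangement (x y z : ℕ) : ℕ → ℕ → ℕ → Set where
  xyz : IsArrangement x y z x y z
  xzy : IsArrangement x y z x z y
  yxz : IsArrangement x y z y x z
  yzx : IsArrangement x y z y z x
  zxy : IsArrangement x y z z x y
  zyx : IsArrangement x y z z y x

-- Type II: after arranging the entries in nondecreasing order x' ≤ y' ≤ z',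
-- gcd(a, x') = 1, a ∣ y' and a ∣ z'.  (The nondecreasing arrangement is unique
-- as a sequence of values, so the existential is the same as "the" sorted order.)
TypeII : ℕ → ℕ → ℕ → ℕ → Set
TypeII a x y z =
  ∃[ x' ] ∃[ y' ] ∃[ z' ]
    (IsArrangement x y z x' y' z' × x' ≤ y' × y' ≤ z' ×
     gcd a x' ≡ 1 × a ∣ y' × a ∣ z')

{-# OPTIONS --safe #-}
-- Clearing denominators, both sides of 4/p = 1/duv + 1/dup + 1/dvp carry the factor d²uvp², so the
-- equation is 4duv = p + u + v, i.e. (4du − 1)v = p + u: solutions correspond to n = u with quotient v.
-- Since u + v ≤ 2duv, the same equation gives p ≥ 2duv; hence the smallest entry duv is prime to p,
-- while dup and dvp are multiples of p.
module Submission where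

open import Defs
open import Data.Nat using (ℕ; _+_; _*_; _∸_; _≤_; _<_; s≤s; z≤n; NonZero; >-nonZero; >-nonZero⁻¹)
open import Data.Nat.Coprimality using (prime⇒coprime; coprime⇒gcd≡1)
open import Data.Nat.Divisibility using (_∣_; divides; n∣m*n; quotient≢0)
open import Data.Nat.GCD using (gcd)
open import Data.Nat.Primality using (Prime; prime⇒nonZero)
open import Data.Nat.Properties
open import Data.Nat.Tactic.RingSolver using (solve-∀)
open import Data.Product using (∃-syntax; _×_; _,_)
open import Data.Sum using (inj₁; inj₂)
open import Function.Bundles using (_⇔_; mk⇔; Equivalence)
open import Relation.Binary.PropositionalEquality using (_≡_; sym; trans; cong; module ≡-Reasoning)

open Equivalence using (to; from)

typeII-intro : ∀ {a x y z} → gcd a x ≡ 1 → x ≤ y → x ≤ z → a ∣ y → a ∣ z → TypeII a x y z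
typeII-intro {y = y} {z} gcd≡1 x≤y x≤z a∣y a∣z with ≤-total y z
... | inj₁ y≤z = _ , _ , _ , xyz , x≤y , y≤z , gcd≡1 , a∣y , a∣z
... | inj₂ z≤y = _ , _ , _ , xzy , x≤z , z≤y , gcd≡1 , a∣z , a∣y

m*n≡o+n⇔o≡n*[m∸1] : ∀ {m n o} → 1 ≤ m → m * n ≡ o + n ⇔ o ≡ n * (m ∸ 1)
m*n≡o+n⇔o≡n*[m∸1] {m} {n} {o} (s≤s z≤n) = mk⇔ ⇒ ⇐
  where
  open ≡-Reasoning
  m-1 = m ∸ 1
  ⇒ : n + m-1 * n ≡ o + n → o ≡ n * m-1
  ⇒ eq = begin
    o        ≡⟨ +-cancelʳ-≡ n (m-1 * n) o (trans (+-comm (m-1 * n) n) eq) ⟨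
    m-1 * n  ≡⟨ *-comm m-1 n ⟩
    n * m-1  ∎
  ⇐ : o ≡ n * m-1 → n + m-1 * n ≡ o + n
  ⇐ eq = begin
    n + m-1 * n  ≡⟨ +-comm n (m-1 * n) ⟩
    m-1 * n + n  ≡⟨ cong (_+ n) (trans (*-comm m-1 n) (sym eq)) ⟩
    o + n        ∎

common-factor-lhs : ∀ d u v p →
  4 * (d * u * v) * (d * u * p) * (d * v * p) ≡ (d * d * u * v * p * p) * (4 * d * u * v)
common-factor-lhs = solve-∀

common-factor-rhs : ∀ d u v p →
  p * ((d * u * p) * (d * v * p) + (d * u * v) * (d * v * p) + (d * u * v) * (d * u * p))
    ≡ (d * d * u * v * p * p) * (p + u + v)
common-factor-rhs = solve-∀

isSolution⇔ : ∀ {p d u v} → 1 ≤ p → 1 ≤ d → 1 ≤ u → 1 ≤ v →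
  IsSolution p (d * u * v) (d * u * p) (d * v * p) ⇔ 4 * d * u * v ≡ p + u + v
isSolution⇔ {p} {d} {u} {v} (s≤s z≤n) (s≤s z≤n) (s≤s z≤n) (s≤s z≤n) = mk⇔ ⇒ ⇐
  where
  open ≡-Reasoning
  ⇒ : IsSolution p (d * u * v) (d * u * p) (d * v * p) → 4 * d * u * v ≡ p + u + v
  ⇒ (_ , _ , _ , eq) = *-cancelˡ-≡ _ _ (d * d * u * v * p * p) (begin
    (d * d * u * v * p * p) * (4 * d * u * v)  ≡⟨ common-factor-lhs d u v p ⟨
    4 * (d * u * v) * (d * u * p) * (d * v * p) ≡⟨ eq ⟩
    p * ((d * u * p) * (d * v * p) + (d * u * v) * (d * v * p) + (d * u * v) * (d * u * p))
      ≡⟨ common-factor-rhs d u v p ⟩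
    (d * d * u * v * p * p) * (p + u + v)      ∎)
  ⇐ : 4 * d * u * v ≡ p + u + v → IsSolution p (d * u * v) (d * u * p) (d * v * p)
  ⇐ eq = s≤s z≤n , s≤s z≤n , s≤s z≤n , (begin
    4 * (d * u * v) * (d * u * p) * (d * v * p) ≡⟨ common-factor-lhs d u v p ⟩
    (d * d * u * v * p * p) * (4 * d * u * v)  ≡⟨ cong (d * d * u * v * p * p *_) eq ⟩
    (d * d * u * v * p * p) * (p + u + v)      ≡⟨ common-factor-rhs d u v p ⟨
    p * ((d * u * p) * (d * v * p) + (d * u * v) * (d * v * p) + (d * u * v) * (d * u * p)) ∎)

four-copies : ∀ d u v → d * u * v + d * u * v + (d * u * v + d * u * v) ≡ 4 * d * u * v
four-copies = solve-∀

duv<p : ∀ {p d u v} → 1 ≤ d → 1 ≤ u → 1 ≤ v → 4 * d * u * v ≡ p + u + v → d * u * v < p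
duv<p {p} {d} {u} {v} (s≤s z≤n) (s≤s z≤n) (s≤s z≤n) eq = <-≤-trans (m<m+n x (s≤s z≤n)) x+x≤p
  where
  open ≤-Reasoning
  x = d * u * v
  u+v≤x+x : u + v ≤ x + x
  u+v≤x+x = +-mono-≤ (≤-trans (m≤n*m u d) (m≤m*n (d * u) v)) (m≤n*m v (d * u))
  x+x≤p : x + x ≤ p
  x+x≤p = +-cancelʳ-≤ (u + v) (x + x) p (begin
    x + x + (u + v)  ≤⟨ +-monoʳ-≤ (x + x) u+v≤x+x ⟩
    x + x + (x + x)  ≡⟨ four-copies d u v ⟩
    4 * d * u * v    ≡⟨ eq ⟩
    p + u + v        ≡⟨ +-assoc p u v ⟩
    p + (u + v)      ∎)

typeII-of-duv<p : ∀ {p d u v} → Prime p → 1 ≤ d → 1 ≤ u → 1 ≤ v → d * u * v < p →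
  TypeII p (d * u * v) (d * u * p) (d * v * p)
typeII-of-duv<p {p} {d} {u} {v} p-prime (s≤s z≤n) (s≤s z≤n) (s≤s z≤n) duv<p =
  typeII-intro (coprime⇒gcd≡1 (prime⇒coprime p-prime duv<p))
    (below-multiple (d * u)) (below-multiple (d * v)) (n∣m*n (d * u)) (n∣m*n (d * v))
  where
  below-multiple : ∀ m .{{_ : NonZero m}} → d * u * v ≤ m * p
  below-multiple m = ≤-trans (<⇒≤ duv<p) (m≤n*m p m)

theorem4 : (p d : ℕ) → Prime p → 1 ≤ d →
    ((∃[ u ] ∃[ v ] (1 ≤ u × 1 ≤ v × IsSolution p (d * u * v) (d * u * p) (d * v * p)))
      ⇔ (∃[ n ] (1 ≤ n × (4 * d * n ∸ 1) ∣ (p + n))))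
    × ((u v : ℕ) → 1 ≤ u → 1 ≤ v → IsSolution p (d * u * v) (d * u * p) (d * v * p) →
        TypeII p (d * u * v) (d * u * p) (d * v * p))
theorem4 p d p-prime 1≤d = mk⇔ solution⇒divisor divisor⇒solution , solution⇒typeII
  where
  1≤p : 1 ≤ p
  1≤p = >-nonZero⁻¹ p {{prime⇒nonZero p-prime}}
  1≤4du : ∀ {u} → 1 ≤ u → 1 ≤ 4 * d * u
  1≤4du {u} 1≤u = *-mono-≤ {1} {4 * d} {1} {u} (*-mono-≤ {1} {4} {1} {d} (s≤s z≤n) 1≤d) 1≤u
  solution⇒divisor : ∃[ u ] ∃[ v ] (1 ≤ u × 1 ≤ v × IsSolution p (d * u * v) (d * u * p) (d * v * p))
    → ∃[ n ] (1 ≤ n × (4 * d * n ∸ 1) ∣ (p + n))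
  solution⇒divisor (u , v , 1≤u , 1≤v , sol) =
    u , 1≤u , divides v (to (m*n≡o+n⇔o≡n*[m∸1] (1≤4du 1≤u)) (to (isSolution⇔ 1≤p 1≤d 1≤u 1≤v) sol))
  divisor⇒solution : ∃[ n ] (1 ≤ n × (4 * d * n ∸ 1) ∣ (p + n))
    → ∃[ u ] ∃[ v ] (1 ≤ u × 1 ≤ v × IsSolution p (d * u * v) (d * u * p) (d * v * p))
  divisor⇒solution (n , 1≤n , 4dn∸1∣p+n@(divides k eq)) =
    n , k , 1≤n , 1≤k , from (isSolution⇔ 1≤p 1≤d 1≤n 1≤k) (from (m*n≡o+n⇔o≡n*[m∸1] (1≤4du 1≤n)) eq)
    where
    1≤k : 1 ≤ k
    1≤k = >-nonZero⁻¹ k {{quotient≢0 4dn∸1∣p+n {{>-nonZero (≤-trans 1≤p (m≤m+n p n))}}}}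
  solution⇒typeII : (u v : ℕ) → 1 ≤ u → 1 ≤ v → IsSolution p (d * u * v) (d * u * p) (d * v * p) →
    TypeII p (d * u * v) (d * u * p) (d * v * p)
  solution⇒typeII u v 1≤u 1≤v sol =
    typeII-of-duv<p p-prime 1≤d 1≤u 1≤v (duv<p 1≤d 1≤u 1≤v (to (isSolution⇔ 1≤p 1≤d 1≤u 1≤v) sol))
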